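{- Consider an iteration of \textsc{Window Sort} on an arrangement $\sigma$ of $n$ elements, producing the arrangement $\sigma'$. If $|computed\_rank(x)-x|\le m$ for every element $x$, then $|\sigma'(x)-x|\le 2m$ for every element $x$.
   Context: Elements are $\{1,\dots,n\}$, identified with their true ranks; comparisons are recurrent (each pair's outcome is fixed, possibly erroneous). $\sigma(x)$ is the position of $x$. \textsc{Window Sort} iteration with window size $w$ on $\sigma$: for each element $x$, with $l=\sigma(x)$, $wins(x)$ is the number of elements $y$ with $\sigma(y)\in[l-2w,l-1]\cup[l+1,l+2w]$ for which the comparison reports $x>y$, and $computed\_rank(x)=\max\{l-2w,0\}+wins(x)$. Then $\sigma'$ is obtained by placing the elements in order of non-decreasing computed rank, ties broken arbitrarily; $\sigma'(x)$ is the computed position of $x$. -}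

module Defs where

open import Data.Bool using (Bool; true; false; _∧_; _∨_; not; if_then_else_)
open import Data.Nat using (ℕ; zero; suc; _+_; _*_; _∸_; _≤ᵇ_; _<ᵇ_; _<_; _≤_; ∣_-_∣)
open import Data.Fin using (Fin; toℕ)
open import Data.Fin.Permutation using (Permutation′; _⟨$⟩ʳ_)
open import Data.List using (List; map; allFin)
open import Data.Nat.ListAction using (sum)
open import Relation.Binary.PropositionalEquality using (_≡_; _≢_)

-- Elements are Fin n; element x has true rank  rank x = toℕ x + 1  (so ranks are 1..n).
rank : {n : ℕ} → Fin n → ℕ
rank x = suc (toℕ x)

-- An arrangement σ is a permutation sending each element to its position (0-based Fin);
-- the 1-based position of x is pos σ x = toℕ (σ x) + 1.
Arrangement : ℕ → Set
Arrangement n = Permutation′ n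

pos : {n : ℕ} → Arrangement n → Fin n → ℕ
pos σ x = suc (toℕ (σ ⟨$⟩ʳ x))

-- Recurrent comparisons: a fixed (possibly erroneous) outcome per pair.
-- cmp x y ≡ true means "the comparison reports x > y".
Comparison : ℕ → Set
Comparison n = Fin n → Fin n → Bool

Consistent : {n : ℕ} → Comparison n → Set
Consistent {n} cmp = (x y : Fin n) → x ≢ y → cmp x y ≡ not (cmp y x)

-- p ∈ [l-2w, l-1] ∪ [l+1, l+2w]  (positions are ≥ 1, so the left end is max(l-2w,0) = l ∸ 2w)
inWindow : ℕ → ℕ → ℕ → Bool
inWindow w l p = (((l ∸ 2 * w) ≤ᵇ p) ∧ (p <ᵇ l)) ∨ ((l <ᵇ p) ∧ (p ≤ᵇ (l + 2 * w)))

count : {n : ℕ} → (Fin n → Bool) → ℕ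
count {n} P = sum (map (λ y → if P y then 1 else 0) (allFin n))

wins : {n : ℕ} → Comparison n → ℕ → Arrangement n → Fin n → ℕ
wins cmp w σ x = count (λ y → inWindow w (pos σ x) (pos σ y) ∧ cmp x y)

-- computed_rank(x) = max{l - 2w, 0} + wins(x)
computedRank : {n : ℕ} → Comparison n → ℕ → Arrangement n → Fin n → ℕ
computedRank cmp w σ x = (pos σ x ∸ 2 * w) + wins cmp w σ x

-- σ' is a result of the iteration: an arrangement listing the elements in
-- non-decreasing order of computed rank (ties broken arbitrarily).
IsWindowSortStep : {n : ℕ} → Comparison n → ℕ → Arrangement n → Arrangement n → Set
IsWindowSortStep {n} cmp w σ σ' =
  (x y : Fin n) → computedRank cmp w σ x < computedRank cmp w σ y → pos σ' x < pos σ' y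

module Submission where

-- Write π = σ' for the output arrangement and d = 2m.  If two elements
-- have true ranks more than 2m apart, their computed ranks (each within m of
-- the true rank) are strictly ordered, so σ' places them in the same order.
-- Hence σ' is a permutation π of {0,…,n-1} that never inverts a pair whose
-- indices differ by more than d, and every such permutation moves each index
-- by at most d: if π x + d < x, then the π x + 1 indices 0,…,π x all lie more
-- than d below x, so π sends them injectively into the π x slots below π x;
-- if x + d < π x, the n - π x indices π x,…,n-1 all lie more than d above x
-- and are sent into the n - π x - 1 slots above π x.  Both are ruled out by
-- the pigeonhole principle.

open import Defs
open import Data.Nat using (ℕ; _*_; _≤_; ∣_-_∣)
open import Data.Fin using (Fin)
open import Data.Nat using (suc; _+_; _∸_; _<_; z≤n; s≤s; s≤s⁻¹)
open import Data.Nat.Properties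
open import Data.Fin using (toℕ; fromℕ<)
open import Data.Fin.Properties using (toℕ-fromℕ<; toℕ-injective; injective⇒≤; toℕ<n)
open import Data.Fin.Permutation using (_⟨$⟩ʳ_)
open import Function.Bundles using (Injection)
open import Function.Definitions using (Injective)
open import Function.Properties.Inverse using (↔⇒↣)
open import Relation.Binary.PropositionalEquality using (_≡_; sym; trans; cong)
open import Relation.Nullary using (¬_)

∣-∣≤-intro : ∀ a b k → a ≤ b + k → b ≤ a + k → ∣ a - b ∣ ≤ k
∣-∣≤-intro 0       b       k _             b≤k           = b≤k
∣-∣≤-intro (suc a) 0       k a≤k           _             = a≤k
∣-∣≤-intro (suc a) (suc b) k (s≤s a≤b+k) (s≤s b≤a+k) = ∣-∣≤-intro a b k a≤b+k b≤a+k

interval-pigeonhole : ∀ {k lo hi} (g : Fin k → ℕ) → Injective _≡_ _≡_ g →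
  (∀ i → lo ≤ g i) → (∀ i → g i < hi) → k ≤ hi ∸ lo
interval-pigeonhole {k} {lo} {hi} g g-inj lo≤g g<hi = injective⇒≤ {f = slot} slot-inj
  where
  slot-bound : ∀ i → g i ∸ lo < hi ∸ lo
  slot-bound i = ∸-monoˡ-< (g<hi i) (lo≤g i)
  slot : Fin k → Fin (hi ∸ lo)
  slot i = fromℕ< (slot-bound i)
  slot-inj : Injective _≡_ _≡_ slot
  slot-inj {i} {j} eq = g-inj (∸-cancelʳ-≡ (lo≤g i) (lo≤g j)
    (trans (sym (toℕ-fromℕ< (slot-bound i))) (trans (cong toℕ eq) (toℕ-fromℕ< (slot-bound j)))))

module Block {n : ℕ} (lo : ℕ) {k : ℕ} (fits : lo + k ≤ n) where

  block : Fin k → Fin n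
  block i = fromℕ< (≤-trans (+-monoʳ-< lo (toℕ<n i)) fits)

  toℕ-block : ∀ i → toℕ (block i) ≡ lo + toℕ i
  toℕ-block i = toℕ-fromℕ< _

  block-injective : Injective _≡_ _≡_ block
  block-injective {i} {j} eq = toℕ-injective (+-cancelˡ-≡ lo (toℕ i) (toℕ j)
    (trans (sym (toℕ-block i)) (trans (cong toℕ eq) (toℕ-block j))))

module Displacement {n d : ℕ} (π : Fin n → Fin n) (π-injective : Injective _≡_ _≡_ π)
  (gap-preserving : ∀ a b → toℕ a + d < toℕ b → toℕ (π a) < toℕ (π b)) where

  image : ∀ lo {k} → lo + k ≤ n → Fin k → ℕ
  image lo fits i = toℕ (π (Block.block lo fits i))

  image-injective : ∀ lo {k} (fits : lo + k ≤ n) → Injective _≡_ _≡_ (image lo fits)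
  image-injective lo fits eq = Block.block-injective lo fits (π-injective (toℕ-injective eq))

  -- The indices 0,…,π x would all lie more than d below x and land below π x.
  no-jump-down : ∀ x → ¬ (toℕ (π x) + d < toℕ x)
  no-jump-down x jump = 1+n≰n (interval-pigeonhole (image 0 fits) (image-injective 0 fits)
      (λ _ → z≤n) lands-below)
    where
    fits : suc (toℕ (π x)) ≤ n
    fits = toℕ<n (π x)
    lands-below : ∀ i → image 0 fits i < toℕ (π x)
    lands-below i = gap-preserving _ x (≤-<-trans (+-monoˡ-≤ d below-p) jump)
      where
      below-p : toℕ (Block.block 0 fits i) ≤ toℕ (π x)
      below-p = ≤-trans (≤-reflexive (Block.toℕ-block 0 fits i)) (s≤s⁻¹ (toℕ<n i))

  -- The indices π x,…,n-1 would all lie more than d above x and land above π x.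
  no-jump-up : ∀ x → ¬ (toℕ x + d < toℕ (π x))
  no-jump-up x jump = <⇒≱ (∸-monoʳ-< (n<1+n p) (toℕ<n (π x)))
      (interval-pigeonhole (image p fits) (image-injective p fits) lands-above (λ _ → toℕ<n _))
    where
    p : ℕ
    p = toℕ (π x)
    fits : p + (n ∸ p) ≤ n
    fits = ≤-reflexive (m+[n∸m]≡n (<⇒≤ (toℕ<n (π x))))
    above-x : ∀ i → toℕ x + d < toℕ (Block.block p fits i)
    above-x i = <-≤-trans jump (≤-trans (m≤m+n p (toℕ i)) (≤-reflexive (sym (Block.toℕ-block p fits i))))
    lands-above : ∀ i → suc p ≤ image p fits i
    lands-above i = gap-preserving x _ (above-x i)

  displacement : ∀ x → ∣ toℕ (π x) - toℕ x ∣ ≤ d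
  displacement x = ∣-∣≤-intro (toℕ (π x)) (toℕ x) d (≮⇒≥ (no-jump-up x)) (≮⇒≥ (no-jump-down x))

approximation-preserves-gaps : ∀ {c r c′ r′ m} → ∣ c - r ∣ ≤ m → ∣ c′ - r′ ∣ ≤ m →
  r + 2 * m < r′ → c < c′
approximation-preserves-gaps {c} {r} {c′} {r′} {m} close close′ gap =
  +-cancelʳ-< m c c′ (begin-strict
    c + m         ≤⟨ +-monoˡ-≤ m (≤-trans (m≤n+∣m-n∣ c r) (+-monoʳ-≤ r close)) ⟩
    r + m + m     ≡⟨ +-assoc r m m ⟩
    r + (m + m)   ≡⟨ cong (λ k → r + (m + k)) (sym (+-identityʳ m)) ⟩
    r + 2 * m     <⟨ gap ⟩
    r′            ≤⟨ ≤-trans (m≤n+∣n-m∣ r′ c′) (+-monoʳ-≤ c′ close′) ⟩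
    c′ + m        ∎)
  where open ≤-Reasoning

mainTheorem10 : (n : ℕ) (cmp : Comparison n) → Consistent cmp →
    (w m : ℕ) (σ σ' : Arrangement n) → IsWindowSortStep cmp w σ σ' →
    ((x : Fin n) → ∣ computedRank cmp w σ x - rank x ∣ ≤ m) →
    (x : Fin n) → ∣ pos σ' x - rank x ∣ ≤ 2 * m
mainTheorem10 n cmp _ w m σ σ' step close =
  Displacement.displacement (σ' ⟨$⟩ʳ_) (Injection.injective (↔⇒↣ σ')) gap-preserving
  where
  gap-preserving : ∀ a b → toℕ a + 2 * m < toℕ b → toℕ (σ' ⟨$⟩ʳ a) < toℕ (σ' ⟨$⟩ʳ b)
  gap-preserving a b gap = s≤s⁻¹ (step a b (approximation-preserves-gaps (close a) (close b) (s≤s gap)))
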